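{- For each gadget $\gamma$ (from $\Pi$-structures to $\Sigma$-structures) there is a projective gadget $\gamma'$ (from $\Pi^*$-structures to $\Sigma$-structures) such that $\gamma(\mathbf X)$ and $\gamma'(\rho(\mathbf X))$ are isomorphic for all $\Pi$-structures $\mathbf X$, where $\rho$ is reification.
   Context: Signatures and structures: a (multisorted relational) signature consists of types and relational symbols, each $R$ with arity $\mathrm{ar}_R$ a tuple of types; a structure has a set $A_t$ per type (elements of different types distinct) and relations $R^{\mathbf A}\subseteq A_{\mathrm{ar}_R(1)}\times\dots\times A_{\mathrm{ar}_R(k)}$; homomorphisms are type-wise maps preserving relations. Gadget $\gamma$ from $\Pi$ to $\Sigma$: a $\Sigma$-structure $\mathbf D_t$ per $\Pi$-type $t$, a $\Sigma$-structure $\mathbf R^\gamma$ per $\Pi$-symbol $R$, and homomorphisms $p_{R,i}\colon\mathbf D_{\mathrm{ar}_R(i)}\to\mathbf R^\gamma$ ($i\in[k]$, $k$ the arity of $R$). $\gamma(\mathbf A)$: disjoint union of a copy of $\mathbf D_t$ (elements $(a;d)$) for each $a\in A_t$ and a copy of $\mathbf R^\gamma$ (elements $(a;e)$) for each $a\in R^{\mathbf A}$, quotiented by the equivalence generated by $(a;p_{R,i}(e))=(a_i;e)$ for all $R$, $a\in R^{\mathbf A}$, $i$, $e\in\mathbf D_{\mathrm{ar}_R(i)}$; relations are the images of relations of the copies. Projective gadget $\gamma'$ from a signature $\Pi'$ all of whose symbols are binary to $\Sigma$: a $\Sigma$-structure $\mathbf D_t$ per $\Pi'$-type $t$ and a homomorphism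 $p_R\colon\mathbf D_s\to\mathbf D_t$ for each $\Pi'$-symbol $R$ with $\mathrm{ar}_R=(t,s)$. $\gamma'(\mathbf A)$: disjoint union of a copy of $\mathbf D_t$ (elements $(a;d)$) for each $a\in A_t$, quotiented by the equivalence generated by $(a;p_R(d))=(b;d)$ for all $R$ with $\mathrm{ar}_R=(t,s)$, $(a,b)\in R^{\mathbf A}$, $d\in\mathbf D_s$; relations are the images. Reification: $\Pi^*$ has all $\Pi$-types, plus a type (also called $R$) for each $\Pi$-symbol $R$, and a binary symbol $P_{R,i}$ of arity $(R,\mathrm{ar}_R(i))$ for each $\Pi$-symbol $R$ of arity $k$ and $i\in[k]$. For a $\Pi$-structure $\mathbf X$, $\rho(\mathbf X)$ is the $\Pi^*$-structure with domain $X_t$ for each $\Pi$-type $t$, domain $R^{\mathbf X}$ for type $R$, and $P_{R,i}^{\rho(\mathbf X)}=\{((a_1,\dots,a_k),a_i):(a_1,\dots,a_k)\in R^{\mathbf X}\}$. -}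

module Defs where

open import Data.List using (List; []; _∷_; length; lookup)
open import Data.Fin using (Fin; zero; suc)
open import Data.Unit using (⊤; tt)
open import Data.Product using (Σ; _×_; _,_; proj₁; proj₂)
open import Data.Sum using (_⊎_; inj₁; inj₂)
open import Relation.Binary.PropositionalEquality using (_≡_)
open import Relation.Binary.Construct.Closure.Equivalence using (EqClosure)
open import Axiom.UniquenessOfIdentityProofs.WithK using (uip)

Tuple : {T : Set} → (T → Set) → List T → Set
Tuple D []       = ⊤
Tuple D (t ∷ ts) = D t × Tuple D ts

proj : {T : Set} {D : T → Set} (ts : List T) → Tuple D ts → (i : Fin (length ts)) → D (lookup ts i)
proj (t ∷ ts) (x , xs) zero    = x
proj (t ∷ ts) (x , xs) (suc i) = proj ts xs i

mapT : {T : Set} {D E : T → Set} (f : (t : T) → D t → E t) (ts : List T) → Tuple D ts → Tuple E ts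
mapT f []       _        = tt
mapT f (t ∷ ts) (x , xs) = f t x , mapT f ts xs

PointwiseT : {T : Set} {D E : T → Set} (_~_ : (t : T) → D t → E t → Set) (ts : List T) → Tuple D ts → Tuple E ts → Set
PointwiseT _~_ []       _        _        = ⊤
PointwiseT _~_ (t ∷ ts) (x , xs) (y , ys) = _~_ t x y × PointwiseT _~_ ts xs ys

record Signature : Set₁ where
  field
    Ty  : Set
    Sym : Set
    ar  : Sym → List Ty
open Signature public

-- A structure: a set per type and, per symbol R, a subset R^A of the
-- product of the domains (a proof-irrelevant predicate = a subset).
record Structure (Π : Signature) : Set₁ where
  field
    Dom      : Ty Π → Set
    Rel      : (R : Sym Π) → Tuple Dom (ar Π R) → Set
    Rel-prop : (R : Sym Π) (x : Tuple Dom (ar Π R)) (p q : Rel R x) → p ≡ q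
open Structure public

Elems : {Π : Signature} (A : Structure Π) (R : Sym Π) → Set
Elems {Π} A R = Σ (Tuple (Dom A) (ar Π R)) (Rel A R)

record Hom {Π : Signature} (A B : Structure Π) : Set where
  field
    map  : (t : Ty Π) → Dom A t → Dom B t
    pres : (R : Sym Π) (x : Tuple (Dom A) (ar Π R)) → Rel A R x → Rel B R (mapT map (ar Π R) x)
open Hom public

-- Structures presented as quotients (setoid structures):
-- carriers with an equivalence relation; relations are taken up to it.

record QStructure (Σ' : Signature) : Set₁ where
  field
    Car  : Ty Σ' → Set
    _≈_  : (s : Ty Σ') → Car s → Car s → Set
    QRel : (S : Sym Σ') → Tuple Car (ar Σ' S) → Set
open QStructure public

record Iso {Σ' : Signature} (A B : QStructure Σ') : Set where
  field
    to      : (s : Ty Σ') → Car A s → Car B s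
    from    : (s : Ty Σ') → Car B s → Car A s
    to-cong   : (s : Ty Σ') {x y : Car A s} → _≈_ A s x y → _≈_ B s (to s x) (to s y)
    from-cong : (s : Ty Σ') {x y : Car B s} → _≈_ B s x y → _≈_ A s (from s x) (from s y)
    from-to : (s : Ty Σ') (x : Car A s) → _≈_ A s (from s (to s x)) x
    to-from : (s : Ty Σ') (y : Car B s) → _≈_ B s (to s (from s y)) y
    to-rel   : (S : Sym Σ') (x : Tuple (Car A) (ar Σ' S)) → QRel A S x → QRel B S (mapT to (ar Σ' S) x)
    from-rel : (S : Sym Σ') (y : Tuple (Car B) (ar Σ' S)) → QRel B S y → QRel A S (mapT from (ar Σ' S) y)

-- Quotient of a disjoint union of copies of Σ'-structures by the
-- equivalence generated by a relation Gen; relations are the images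
-- of the relations of the copies.
module _ {Σ' : Signature} (Idx : Set) (Cp : Idx → Structure Σ')
         (Gen : (s : Ty Σ') → Σ Idx (λ i → Dom (Cp i) s) → Σ Idx (λ i → Dom (Cp i) s) → Set) where

  quotientOfCopies : QStructure Σ'
  quotientOfCopies = record
    { Car  = λ s → Σ Idx (λ i → Dom (Cp i) s)
    ; _≈_  = λ s → EqClosure (Gen s)
    ; QRel = λ S x → Σ Idx (λ i → Σ (Tuple (Dom (Cp i)) (ar Σ' S)) (λ y →
               Rel (Cp i) S y × PointwiseT (λ s → EqClosure (Gen s)) (ar Σ' S) (mapT (λ s d → (i , d)) (ar Σ' S) y) x))
    }

record Gadget (Π Σ' : Signature) : Set₁ where
  field
    D  : Ty Π → Structure Σ'
    Rγ : Sym Π → Structure Σ'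
    p  : (R : Sym Π) (i : Fin (length (ar Π R))) → Hom (D (lookup (ar Π R) i)) (Rγ R)
open Gadget public

module _ {Π Σ' : Signature} (γ : Gadget Π Σ') (A : Structure Π) where

  GIdx : Set
  GIdx = Σ (Ty Π) (Dom A) ⊎ Σ (Sym Π) (Elems A)

  GCp : GIdx → Structure Σ'
  GCp (inj₁ (t , a)) = D γ t
  GCp (inj₂ (R , a)) = Rγ γ R

  data GGen (s : Ty Σ') : Σ GIdx (λ i → Dom (GCp i) s) → Σ GIdx (λ i → Dom (GCp i) s) → Set where
    glue : (R : Sym Π) (a : Elems A R) (i : Fin (length (ar Π R))) (e : Dom (D γ (lookup (ar Π R) i)) s) →
           GGen s (inj₂ (R , a) , map (p γ R i) s e)
                  (inj₁ (lookup (ar Π R) i , proj (ar Π R) (proj₁ a) i) , e)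

  applyGadget : QStructure Σ'
  applyGadget = quotientOfCopies GIdx GCp GGen

record BinSignature : Set₁ where
  field
    BTy  : Set
    BSym : Set
    fst  : BSym → BTy
    snd  : BSym → BTy
open BinSignature public

toSig : BinSignature → Signature
toSig Π' = record { Ty = BTy Π' ; Sym = BSym Π' ; ar = λ R → fst Π' R ∷ snd Π' R ∷ [] }

record ProjGadget (Π' : BinSignature) (Σ' : Signature) : Set₁ where
  field
    PD : BTy Π' → Structure Σ'
    pp : (R : BSym Π') → Hom (PD (snd Π' R)) (PD (fst Π' R))
open ProjGadget public

module _ {Π' : BinSignature} {Σ' : Signature} (γ' : ProjGadget Π' Σ') (A : Structure (toSig Π')) where

  PIdx : Set
  PIdx = Σ (BTy Π') (Dom A)

  PCp : PIdx → Structure Σ'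
  PCp (t , a) = PD γ' t

  data PGen (s : Ty Σ') : Σ PIdx (λ i → Dom (PCp i) s) → Σ PIdx (λ i → Dom (PCp i) s) → Set where
    glue : (R : BSym Π') (a : Dom A (fst Π' R)) (b : Dom A (snd Π' R)) → Rel A R (a , b , tt) →
           (d : Dom (PD γ' (snd Π' R)) s) →
           PGen s ((fst Π' R , a) , map (pp γ' R) s d) ((snd Π' R , b) , d)

  applyProjGadget : QStructure Σ'
  applyProjGadget = quotientOfCopies PIdx PCp PGen

reifySig : Signature → BinSignature
reifySig Π = record
  { BTy  = Ty Π ⊎ Sym Π
  ; BSym = Σ (Sym Π) (λ R → Fin (length (ar Π R)))
  ; fst  = λ Ri → inj₂ (proj₁ Ri)
  ; snd  = λ Ri → inj₁ (lookup (ar Π (proj₁ Ri)) (proj₂ Ri))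
  }

module _ {Π : Signature} (X : Structure Π) where

  ρDom : Ty Π ⊎ Sym Π → Set
  ρDom (inj₁ t) = Dom X t
  ρDom (inj₂ R) = Elems X R

  ρRel : (Ri : Σ (Sym Π) (λ R → Fin (length (ar Π R)))) →
         Tuple ρDom (inj₂ (proj₁ Ri) ∷ inj₁ (lookup (ar Π (proj₁ Ri)) (proj₂ Ri)) ∷ []) → Set
  ρRel (R , i) (e , a , tt) = proj (ar Π R) (proj₁ e) i ≡ a

  reify : Structure (toSig (reifySig Π))
  reify = record
    { Dom      = ρDom
    ; Rel      = ρRel
    ; Rel-prop = λ { (R , i) (e , a , tt) p q → uip p q }
    }

-- Take D_t for the old types and R^γ for each new type R, with p_{P_{R,i}} := p_{R,i}.
-- Both γ(X) and γ'(ρ(X)) are then quotients of the same copies, indexed by the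
-- elements of X and the tuples of its relations, and the gluing
-- (a ; p_{R,i}(e)) = (a_i ; e) of γ is exactly the gluing of γ' along the pair
-- (a , a_i) ∈ P_{R,i}. So the identity on copies is an isomorphism.
module Submission where

open import Defs
open import Data.List using (List; []; _∷_)
open import Data.Product using (Σ; _,_)
open import Data.Sum using (_⊎_; inj₁; inj₂)
open import Data.Unit using (tt)
open import Relation.Binary.PropositionalEquality using (_≡_; refl; cong₂; subst; sym; trans)
open import Relation.Binary.Construct.Closure.Equivalence using (EqClosure; gmap)
open import Relation.Binary.Construct.Closure.ReflexiveTransitive using (ε)

mapT-id : {T : Set} {D : T → Set} (ts : List T) (x : Tuple D ts) → mapT (λ _ d → d) ts x ≡ x
mapT-id []       _        = refl
mapT-id (t ∷ ts) (x , xs) = cong₂ _,_ refl (mapT-id ts xs)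

mapT-∘ : {T : Set} {D E F : T → Set} (f : (t : T) → E t → F t) (g : (t : T) → D t → E t)
         (ts : List T) (x : Tuple D ts) →
         mapT f ts (mapT g ts x) ≡ mapT (λ t d → f t (g t d)) ts x
mapT-∘ f g []       _        = refl
mapT-∘ f g (t ∷ ts) (x , xs) = cong₂ _,_ refl (mapT-∘ f g ts xs)

PointwiseT-mapT : {T : Set} {D E : T → Set}
                  {_~_ : (t : T) → D t → D t → Set} {_≋_ : (t : T) → E t → E t → Set}
                  (f : (t : T) → D t → E t) → (∀ t {x y} → _~_ t x y → _≋_ t (f t x) (f t y)) →
                  (ts : List T) (x y : Tuple D ts) →
                  PointwiseT _~_ ts x y → PointwiseT _≋_ ts (mapT f ts x) (mapT f ts y)
PointwiseT-mapT f f-cong []       _        _        _        = tt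
PointwiseT-mapT f f-cong (t ∷ ts) (x , xs) (y , ys) (p , ps) =
  f-cong t p , PointwiseT-mapT f f-cong ts xs ys ps

idHom : {Σ' : Signature} (A : Structure Σ') → Hom A A
idHom {Σ'} A = record
  { map  = λ _ d → d
  ; pres = λ S x r → subst (Rel A S) (sym (mapT-id (ar Σ' S) x)) r
  }

module CopyMorphism {Σ' : Signature} {I J : Set}
  (CpI : I → Structure Σ') (GenI : (s : Ty Σ') → Σ I (λ i → Dom (CpI i) s) → Σ I (λ i → Dom (CpI i) s) → Set)
  (CpJ : J → Structure Σ') (GenJ : (s : Ty Σ') → Σ J (λ j → Dom (CpJ j) s) → Σ J (λ j → Dom (CpJ j) s) → Set)
  (f : I → J) (φ : (i : I) → Hom (CpI i) (CpJ (f i)))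
  where

  private
    A = quotientOfCopies I CpI GenI
    B = quotientOfCopies J CpJ GenJ

  copyMap : (s : Ty Σ') → Car A s → Car B s
  copyMap s (i , d) = f i , map (φ i) s d

  module _ (copyMap-gen : ∀ s {x y} → GenI s x y → GenJ s (copyMap s x) (copyMap s y)) where

    copyMap-cong : (s : Ty Σ') {x y : Car A s} → _≈_ A s x y → _≈_ B s (copyMap s x) (copyMap s y)
    copyMap-cong s = gmap (copyMap s) (copyMap-gen s)

    copyMap-rel : (S : Sym Σ') (x : Tuple (Car A) (ar Σ' S)) → QRel A S x → QRel B S (mapT copyMap (ar Σ' S) x)
    copyMap-rel S x (i , y , r , y~x) =
      f i , mapT (map (φ i)) ts y , pres (φ i) S y r ,
      subst (λ z → PointwiseT (_≈_ B) ts z (mapT copyMap ts x))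
            (trans (mapT-∘ copyMap (λ s d → (i , d)) ts y)
                   (sym (mapT-∘ (λ s d → (f i , d)) (map (φ i)) ts y)))
            (PointwiseT-mapT copyMap copyMap-cong ts _ x y~x)
      where ts = ar Σ' S

module _ {Σ' : Signature} {I J : Set}
  (CpI : I → Structure Σ') (GenI : (s : Ty Σ') → Σ I (λ i → Dom (CpI i) s) → Σ I (λ i → Dom (CpI i) s) → Set)
  (CpJ : J → Structure Σ') (GenJ : (s : Ty Σ') → Σ J (λ j → Dom (CpJ j) s) → Σ J (λ j → Dom (CpJ j) s) → Set)
  where

  private
    module F = CopyMorphism CpI GenI CpJ GenJ
    module G = CopyMorphism CpJ GenJ CpI GenI

  quotientOfCopies-iso :
    (f : I → J) (φ : (i : I) → Hom (CpI i) (CpJ (f i)))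
    (g : J → I) (ψ : (j : J) → Hom (CpJ j) (CpI (g j))) →
    (∀ s {x y} → GenI s x y → GenJ s (F.copyMap f φ s x) (F.copyMap f φ s y)) →
    (∀ s {x y} → GenJ s x y → GenI s (G.copyMap g ψ s x) (G.copyMap g ψ s y)) →
    (∀ s x → EqClosure (GenI s) (G.copyMap g ψ s (F.copyMap f φ s x)) x) →
    (∀ s y → EqClosure (GenJ s) (F.copyMap f φ s (G.copyMap g ψ s y)) y) →
    Iso (quotientOfCopies I CpI GenI) (quotientOfCopies J CpJ GenJ)
  quotientOfCopies-iso f φ g ψ f-gen g-gen g∘f f∘g = record
    { to        = F.copyMap f φ
    ; from      = G.copyMap g ψ
    ; to-cong   = F.copyMap-cong f φ f-gen
    ; from-cong = G.copyMap-cong g ψ g-gen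
    ; from-to   = g∘f
    ; to-from   = f∘g
    ; to-rel    = F.copyMap-rel f φ f-gen
    ; from-rel  = G.copyMap-rel g ψ g-gen
    }

module _ {Π Σ' : Signature} (γ : Gadget Π Σ') where

  projectiveGadget : ProjGadget (reifySig Π) Σ'
  projectiveGadget = record { PD = copy ; pp = λ (R , i) → p γ R i }
    where
    copy : Ty Π ⊎ Sym Π → Structure Σ'
    copy (inj₁ t) = D γ t
    copy (inj₂ R) = Rγ γ R

  module _ (X : Structure Π) where

    private
      γ' = projectiveGadget
      ρX = reify X

    toIdx : GIdx γ X → PIdx γ' ρX
    toIdx (inj₁ (t , a)) = inj₁ t , a
    toIdx (inj₂ (R , a)) = inj₂ R , a

    fromIdx : PIdx γ' ρX → GIdx γ X
    fromIdx (inj₁ t , a) = inj₁ (t , a)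
    fromIdx (inj₂ R , a) = inj₂ (R , a)

    toCopy : (i : GIdx γ X) → Hom (GCp γ X i) (PCp γ' ρX (toIdx i))
    toCopy (inj₁ _) = idHom _
    toCopy (inj₂ _) = idHom _

    fromCopy : (j : PIdx γ' ρX) → Hom (PCp γ' ρX j) (GCp γ X (fromIdx j))
    fromCopy (inj₁ _ , _) = idHom _
    fromCopy (inj₂ _ , _) = idHom _

    to : (s : Ty Σ') → Car (applyGadget γ X) s → Car (applyProjGadget γ' ρX) s
    to = CopyMorphism.copyMap (GCp γ X) (GGen γ X) (PCp γ' ρX) (PGen γ' ρX) toIdx toCopy

    from : (s : Ty Σ') → Car (applyProjGadget γ' ρX) s → Car (applyGadget γ X) s
    from = CopyMorphism.copyMap (PCp γ' ρX) (PGen γ' ρX) (GCp γ X) (GGen γ X) fromIdx fromCopy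

    glue-to : ∀ s {x y} → GGen γ X s x y → PGen γ' ρX s (to s x) (to s y)
    glue-to s (glue R a i e) = glue (R , i) a _ refl e

    glue-from : ∀ s {x y} → PGen γ' ρX s x y → GGen γ X s (from s x) (from s y)
    glue-from s (glue (R , i) a _ refl d) = glue R a i d

    from∘to : ∀ s x → EqClosure (GGen γ X s) (from s (to s x)) x
    from∘to s (inj₁ _ , _) = ε
    from∘to s (inj₂ _ , _) = ε

    to∘from : ∀ s y → EqClosure (PGen γ' ρX s) (to s (from s y)) y
    to∘from s ((inj₁ _ , _) , _) = ε
    to∘from s ((inj₂ _ , _) , _) = ε

    gadget≅projectiveGadget∘reify : Iso (applyGadget γ X) (applyProjGadget γ' ρX)
    gadget≅projectiveGadget∘reify =
      quotientOfCopies-iso (GCp γ X) (GGen γ X) (PCp γ' ρX) (PGen γ' ρX)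
        toIdx toCopy fromIdx fromCopy glue-to glue-from from∘to to∘from

lemmaA11 : {Π Σ' : Signature} (γ : Gadget Π Σ') →
    Σ (ProjGadget (reifySig Π) Σ') (λ γ' →
      (X : Structure Π) → Iso (applyGadget γ X) (applyProjGadget γ' (reify X)))
lemmaA11 γ = projectiveGadget γ , gadget≅projectiveGadget∘reify γ
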